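{- Let $\Pi$ be a signed bipartite graph with root $r$. Then the signed graph $SK_8[\Pi]$ is not sign-symmetric.
   Context: A signed graph $\Sigma=(G,\sigma)$ is a simple graph $G$ with a sign function $\sigma:E(G)\to\{+1,-1\}$; a signed bipartite graph is one whose underlying graph is bipartite. $-\Sigma=(G,-\sigma)$. Resigning at a vertex $v$ negates the signs of all edges incident with $v$; two signed graphs on the same graph are switching equivalent if one is obtained from the other by a sequence of resignings. An isomorphism of signed graphs $(G,\sigma)\to(H,\pi)$ is a graph isomorphism $\varphi$ with $\sigma(uv)=\pi(\varphi(u)\varphi(v))$ for all edges $uv$. $\Sigma$ and $\Pi$ are switching isomorphic if some isomorphic image of $\Sigma$ is switching equivalent to $\Pi$. $\Sigma$ is sign-symmetric if $\Sigma$ is switching isomorphic to $-\Sigma$. $SK_8$ is the signed complete graph on vertices $p_1,\ldots,p_8$ in which the edges $p_3p_4,p_3p_5,p_4p_5,p_4p_6,p_4p_7,p_5p_7,p_5p_8,p_6p_7,p_7p_8$ are negative and all other edges are positive. For a signed graph $\Sigma$ with vertices $v_1,\ldots,v_n$ and a rooted signed graph $\Pi$ (a signed graph with a distinguished root vertex), the rooted product $\Sigma[\Pi]$ is obtained by taking $\Sigma$ and $n$ disjoint copies of $\Pi$ and identifying each $v_i$ with the root of the $i$-th copy, all edges keeping their signs. -}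

module Defs where

open import Data.Sign.Base using (Sign; opposite) renaming (+ to pos; - to neg)
open import Data.Maybe using (Maybe; just; nothing) renaming (map to mmap)
open import Data.Nat using (ℕ; zero; suc)
open import Data.Fin using (Fin; toℕ; _≟_)
open import Data.Bool using (Bool; true; false; _∨_; if_then_else_)
open import Data.Product using (Σ; _×_; _,_)
open import Data.Product.Properties using (≡-dec)
open import Data.List using (List; foldr)
open import Relation.Binary.Definitions using (DecidableEquality)
open import Relation.Binary.PropositionalEquality using (_≡_; _≢_)
open import Relation.Nullary using (yes; no)
open import Function.Bundles using (_↔_; Inverse)

-- A signed graph on vertex set V, encoded by its "signed adjacency":
-- σ u v = nothing  : u, v non-adjacent
-- σ u v = just s   : uv is an edge with sign s
SignFn : Set → Set
SignFn V = V → V → Maybe Sign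

record IsSignedGraph {V : Set} (σ : SignFn V) : Set where
  field
    symmetric : ∀ u v → σ u v ≡ σ v u
    loopless  : ∀ v → σ v v ≡ nothing

IsBipartite : {V : Set} → SignFn V → Set
IsBipartite {V} σ = Σ (V → Bool) λ c → ∀ u v s → σ u v ≡ just s → c u ≢ c v

negate : {V : Set} → SignFn V → SignFn V
negate σ u v = mmap opposite (σ u v)

resign : {V : Set} → DecidableEquality V → V → SignFn V → SignFn V
resign _≟V_ w σ u v with u ≟V w | v ≟V w
... | yes _ | yes _ = σ u v
... | yes _ | no _  = mmap opposite (σ u v)
... | no _  | yes _ = mmap opposite (σ u v)
... | no _  | no _  = σ u v

SwitchingEquivalent : {V : Set} → DecidableEquality V → SignFn V → SignFn V → Set
SwitchingEquivalent {V} dec σ τ =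
  Σ (List V) λ ws → ∀ u v → foldr (resign dec) σ ws u v ≡ τ u v

image : {V W : Set} → V ↔ W → SignFn V → SignFn W
image φ σ x y = σ (Inverse.from φ x) (Inverse.from φ y)

SwitchingIsomorphic : {V W : Set} → DecidableEquality W → SignFn V → SignFn W → Set
SwitchingIsomorphic {V} {W} dec σ τ =
  Σ (V ↔ W) λ φ → SwitchingEquivalent dec (image φ σ) τ

SignSymmetric : {V : Set} → DecidableEquality V → SignFn V → Set
SignSymmetric dec σ = SwitchingIsomorphic dec σ (negate σ)

-- SK_8: vertex p_k is (k-1) : Fin 8.  Negative edges (1-based labels).
negPair : ℕ → ℕ → Bool
negPair 3 4 = true
negPair 3 5 = true
negPair 4 5 = true
negPair 4 6 = true
negPair 4 7 = true
negPair 5 7 = true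
negPair 5 8 = true
negPair 6 7 = true
negPair 7 8 = true
negPair _ _ = false

SK8 : SignFn (Fin 8)
SK8 i j with i ≟ j
... | yes _ = nothing
... | no _  =
  let a = suc (toℕ i) ; b = suc (toℕ j) in
  just (if negPair a b ∨ negPair b a then neg else pos)

-- rooted product Σ[Π] with Σ on Fin n, Π on Fin m rooted at r.
-- Vertex (i , a) = vertex a of the i-th copy of Π; (i , r) is identified with v_i.
rootedProduct : {n m : ℕ} → SignFn (Fin n) → SignFn (Fin m) → Fin m
              → SignFn (Fin n × Fin m)
rootedProduct σ π r (i , a) (j , b) with i ≟ j | a ≟ r | b ≟ r
... | yes _ | _     | _     = π a b
... | no _  | yes _ | yes _ = σ i j
... | no _  | _     | _     = nothing

decProd : {n m : ℕ} → DecidableEquality (Fin n × Fin m)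
decProd = ≡-dec _≟_ _≟_

module Submission where

-- For a signed graph σ let the triangle sign of u, v, x be the
-- product σ(uv)σ(vx)σ(ux) when u, v, x span a triangle.  Resigning at a vertex
-- flips exactly two or none of the three edges of a triangle, so triangle
-- signs are switching invariants, while negating σ flips every triangle sign.
-- Hence a switching isomorphism from σ to -σ yields a map of the vertices
-- that sends every triangle to a triangle of the opposite sign.
--
-- In a rooted product σ[π] with π bipartite (hence triangle-free) and
-- loopless, every triangle lies in the layer of roots, which is a copy of σ.
-- So a sign-symmetry of SK₈[π] induces a triangle-sign-reversing map
-- Fin 8 → Fin 8 for SK₈, and an exhaustive backtracking search, evaluated by
-- the type checker, shows that no such map exists.

open import Defs
open import Data.Nat using (ℕ)
open import Data.Fin using (Fin; #_) renaming (_≟_ to _≟ᶠ_)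

open import Data.Sign.Base using (Sign; opposite; _*_) renaming (+ to pos; - to neg)
open import Data.Sign.Properties using (opposite-involutive)
open import Data.Maybe using (Maybe; just; nothing; zipWith) renaming (map to mmap)
open import Data.Bool using (Bool; true; false; _∧_; _xor_; T)
open import Data.Bool.Properties using (T-∧)
open import Data.Bool.ListAction using (all; any)
open import Data.Product using (∃; _×_; _,_; proj₁; proj₂)
open import Data.Sum using (_⊎_; inj₁; inj₂)
open import Data.Empty using (⊥; ⊥-elim)
open import Data.Unit using (tt)
open import Data.List using (List; []; _∷_; foldr; allFin)
open import Data.List.Relation.Unary.All as All using (All; []; _∷_)
open import Data.List.Relation.Unary.All.Properties using (all⁻)
open import Data.List.Relation.Unary.Any as Any using ()
open import Data.List.Relation.Unary.Any.Properties using (any⁺)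
open import Data.List.Membership.Propositional using (_∈_)
open import Data.List.Membership.Propositional.Properties using (∈-allFin)
open import Relation.Binary.Definitions using (DecidableEquality)
open import Relation.Binary.PropositionalEquality
open import Relation.Nullary using (¬_; Dec; yes; no; does)
open import Function.Bundles using (Inverse; Equivalence)

_·_ : Maybe Sign → Maybe Sign → Maybe Sign
_·_ = zipWith _*_

triangleSign : {V : Set} → SignFn V → V → V → V → Maybe Sign
triangleSign σ u v x = σ u v · (σ v x · σ u x)

flipIf : Bool → Maybe Sign → Maybe Sign
flipIf false e = e
flipIf true  e = mmap opposite e

opposite-*ˡ : ∀ a b → opposite a * b ≡ opposite (a * b)
opposite-*ˡ pos b = refl
opposite-*ˡ neg b = sym (opposite-involutive b)

opposite-*ʳ : ∀ a b → a * opposite b ≡ opposite (a * b)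
opposite-*ʳ pos b = refl
opposite-*ʳ neg b = refl

·-flipIf : ∀ p q e f → flipIf p e · flipIf q f ≡ flipIf (p xor q) (e · f)
·-flipIf false false e        f        = refl
·-flipIf false true  (just a) (just b) = cong just (opposite-*ʳ a b)
·-flipIf true  false (just a) (just b) = cong just (opposite-*ˡ a b)
·-flipIf true  true  (just a) (just b) = cong just (begin
  opposite a * opposite b     ≡⟨ opposite-*ˡ a (opposite b) ⟩
  opposite (a * opposite b)   ≡⟨ cong opposite (opposite-*ʳ a b) ⟩
  opposite (opposite (a * b)) ≡⟨ opposite-involutive (a * b) ⟩
  a * b                       ∎)
  where open ≡-Reasoning
·-flipIf false true  nothing  _        = refl
·-flipIf false true  (just _) nothing  = refl
·-flipIf true  false nothing  _        = refl
·-flipIf true  false (just _) nothing  = refl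
·-flipIf true  true  nothing  _        = refl
·-flipIf true  true  (just _) nothing  = refl

-- Around a triangle every vertex label g occurs twice, so it cancels.
triangleParity : ∀ c a b d → (c xor (a xor b)) xor ((c xor (b xor d)) xor (c xor (a xor d))) ≡ c
triangleParity false false false false = refl
triangleParity false false false true  = refl
triangleParity false false true  false = refl
triangleParity false false true  true  = refl
triangleParity false true  false false = refl
triangleParity false true  false true  = refl
triangleParity false true  true  false = refl
triangleParity false true  true  true  = refl
triangleParity true  false false false = refl
triangleParity true  false false true  = refl
triangleParity true  false true  false = refl
triangleParity true  false true  true  = refl
triangleParity true  true  false false = refl
triangleParity true  true  false true  = refl
triangleParity true  true  true  false = refl
triangleParity true  true  true  true  = refl

-- τ is a twist of σ if every edge uv is flipped by c xor g(u) xor g(v): switching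
-- with respect to the vertex set g (c = false) possibly followed by negation
-- (c = true).
triangleSign-twist : {V : Set} (σ τ : SignFn V) (c : Bool) (g : V → Bool)
  → (∀ u v → τ u v ≡ flipIf (c xor (g u xor g v)) (σ u v))
  → ∀ u v x → triangleSign τ u v x ≡ flipIf c (triangleSign σ u v x)
triangleSign-twist σ τ c g twist u v x = begin
  τ u v · (τ v x · τ u x)
    ≡⟨ cong₂ _·_ (twist u v) (cong₂ _·_ (twist v x) (twist u x)) ⟩
  flipIf puv (σ u v) · (flipIf pvx (σ v x) · flipIf pux (σ u x))
    ≡⟨ cong (flipIf puv (σ u v) ·_) (·-flipIf pvx pux (σ v x) (σ u x)) ⟩
  flipIf puv (σ u v) · flipIf (pvx xor pux) (σ v x · σ u x)
    ≡⟨ ·-flipIf puv (pvx xor pux) (σ u v) (σ v x · σ u x) ⟩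
  flipIf (puv xor (pvx xor pux)) (triangleSign σ u v x)
    ≡⟨ cong (λ p → flipIf p (triangleSign σ u v x)) (triangleParity c (g u) (g v) (g x)) ⟩
  flipIf c (triangleSign σ u v x) ∎
  where
  open ≡-Reasoning
  puv pvx pux : Bool
  puv = c xor (g u xor g v)
  pvx = c xor (g v xor g x)
  pux = c xor (g u xor g x)

-- Resigning at w is the twist by the vertex set {w}.
resign-twist : {V : Set} (dec : DecidableEquality V) (w : V) (σ : SignFn V)
  → ∀ u v → resign dec w σ u v ≡ flipIf (false xor (does (dec u w) xor does (dec v w))) (σ u v)
resign-twist dec w σ u v with dec u w | dec v w
... | yes _ | yes _ = refl
... | yes _ | no _  = refl
... | no _  | yes _ = refl
... | no _  | no _  = refl

triangleSign-resigns : {V : Set} (dec : DecidableEquality V) (σ : SignFn V) (ws : List V)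
  → ∀ u v x → triangleSign (foldr (resign dec) σ ws) u v x ≡ triangleSign σ u v x
triangleSign-resigns dec σ []       u v x = refl
triangleSign-resigns {V} dec σ (w ∷ ws) u v x = begin
  triangleSign (resign dec w σ′) u v x
    ≡⟨ triangleSign-twist σ′ (resign dec w σ′) false (λ y → does (dec y w)) (resign-twist dec w σ′) u v x ⟩
  triangleSign σ′ u v x
    ≡⟨ triangleSign-resigns dec σ ws u v x ⟩
  triangleSign σ u v x ∎
  where
  open ≡-Reasoning
  σ′ : SignFn V
  σ′ = foldr (resign dec) σ ws

triangleSign-negate : {V : Set} (σ : SignFn V)
  → ∀ u v x → triangleSign (negate σ) u v x ≡ flipIf true (triangleSign σ u v x)
triangleSign-negate σ = triangleSign-twist σ (negate σ) true (λ _ → false) (λ _ _ → refl)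

ReversesTriangles : {V W : Set} → SignFn V → SignFn W → (V → W) → Set
ReversesTriangles σ τ f =
  ∀ u v x s → triangleSign σ u v x ≡ just s → triangleSign τ (f u) (f v) (f x) ≡ just (opposite s)

signSymmetric⇒reversal : {V : Set} (dec : DecidableEquality V) (σ : SignFn V)
  → SignSymmetric dec σ → ∃ λ (f : V → V) → ReversesTriangles σ σ f
signSymmetric⇒reversal {V} dec σ (φ , ws , switched) = f , reverses
  where
  f : V → V
  f = Inverse.from φ
  reverses : ReversesTriangles σ σ f
  reverses u v x s eq = begin
    triangleSign (image φ σ) u v x
      ≡⟨ sym (triangleSign-resigns dec (image φ σ) ws u v x) ⟩
    triangleSign (foldr (resign dec) (image φ σ) ws) u v x
      ≡⟨ cong₂ _·_ (switched u v) (cong₂ _·_ (switched v x) (switched u x)) ⟩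
    triangleSign (negate σ) u v x
      ≡⟨ triangleSign-negate σ u v x ⟩
    flipIf true (triangleSign σ u v x)
      ≡⟨ cong (flipIf true) eq ⟩
    just (opposite s) ∎
    where open ≡-Reasoning

record IsEdge {V : Set} (σ : SignFn V) (u v : V) : Set where
  constructor edge
  field
    sign   : Sign
    signed : σ u v ≡ just sign

triangleEdges : {V : Set} (σ : SignFn V) (u v x : V) {s : Sign}
  → triangleSign σ u v x ≡ just s → IsEdge σ u v × IsEdge σ v x × IsEdge σ u x
triangleEdges σ u v x eq with σ u v in uv | σ v x in vx | σ u x in ux
... | just a | just b | just c = edge a uv , edge b vx , edge c ux

noThreeColours : (a b c : Bool) → a ≢ b → b ≢ c → a ≢ c → ⊥
noThreeColours false false _     a≢b _   _   = a≢b refl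
noThreeColours true  true  _     a≢b _   _   = a≢b refl
noThreeColours false true  false _   _   a≢c = a≢c refl
noThreeColours true  false true  _   _   a≢c = a≢c refl
noThreeColours false true  true  _   b≢c _   = b≢c refl
noThreeColours true  false false _   b≢c _   = b≢c refl

bipartite⇒triangleFree : {V : Set} (σ : SignFn V) → IsBipartite σ
  → ∀ u v x {s} → triangleSign σ u v x ≢ just s
bipartite⇒triangleFree σ (colour , proper) u v x eq
  with triangleEdges σ u v x eq
... | edge a uv , edge b vx , edge c ux =
  noThreeColours (colour u) (colour v) (colour x) (proper u v a uv) (proper v x b vx) (proper u x c ux)

module RootedProduct {n m : ℕ} (σ : SignFn (Fin n)) (π : SignFn (Fin m)) (r : Fin m) where

  ρ : SignFn (Fin n × Fin m)
  ρ = rootedProduct σ π r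

  copyEdge : ∀ i a b → ρ (i , a) (i , b) ≡ π a b
  copyEdge i a b with i ≟ᶠ i
  ... | yes _  = refl
  ... | no i≢i = ⊥-elim (i≢i refl)

  rootEdge : ∀ {i j} → i ≢ j → ρ (i , r) (j , r) ≡ σ i j
  rootEdge {i} {j} i≢j with i ≟ᶠ j | r ≟ᶠ r
  ... | yes i≡j | _      = ⊥-elim (i≢j i≡j)
  ... | no _    | yes _  = refl
  ... | no _    | no r≢r = ⊥-elim (r≢r refl)

  sameCopy : ∀ {i j a b} → IsEdge ρ (i , a) (j , b) → a ≢ r ⊎ b ≢ r → i ≡ j
  sameCopy {i} {j} {a} {b} (edge t signed) nonRoot with i ≟ᶠ j | a ≟ᶠ r | b ≟ᶠ r
  ... | yes i≡j | _     | _     = i≡j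
  ... | no _    | yes a≡r | yes b≡r with nonRoot
  ...   | inj₁ a≢r = ⊥-elim (a≢r a≡r)
  ...   | inj₂ b≢r = ⊥-elim (b≢r b≡r)
  sameCopy (edge t ()) _ | no _ | yes _ | no _
  sameCopy (edge t ()) _ | no _ | no _  | _

  rootLayer : (∀ i → σ i i ≡ nothing) → (π r r ≡ nothing)
    → ∀ i j → ρ (i , r) (j , r) ≡ σ i j
  rootLayer σ-loopless π-loopless i j = byCases (i ≟ᶠ j)
    where
    byCases : Dec (i ≡ j) → ρ (i , r) (j , r) ≡ σ i j
    byCases (yes refl) = trans (copyEdge i r r) (trans π-loopless (sym (σ-loopless i)))
    byCases (no i≢j)   = rootEdge i≢j

  noTriangleInCopy : IsBipartite π → ∀ {i j k a b d s} → i ≡ j → j ≡ k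
    → triangleSign ρ (i , a) (j , b) (k , d) ≢ just s
  noTriangleInCopy bip {i} {a = a} {b} {d} refl refl eq =
    bipartite⇒triangleFree π bip a b d (begin
      triangleSign π a b d
        ≡⟨ sym (cong₂ _·_ (copyEdge i a b) (cong₂ _·_ (copyEdge i b d) (copyEdge i a d))) ⟩
      triangleSign ρ (i , a) (i , b) (i , d)
        ≡⟨ eq ⟩
      just _ ∎)
    where open ≡-Reasoning

  triangleAtRoots : IsBipartite π → ∀ i j k a b d {s}
    → triangleSign ρ (i , a) (j , b) (k , d) ≡ just s → a ≡ r × b ≡ r × d ≡ r
  triangleAtRoots bip i j k a b d eq
    with triangleEdges ρ (i , a) (j , b) (k , d) eq | a ≟ᶠ r | b ≟ᶠ r | d ≟ᶠ r
  ... | _ | yes a≡r | yes b≡r | yes d≡r = a≡r , b≡r , d≡r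
  ... | uv , vx , ux | no a≢r | _ | _ =
    ⊥-elim (noTriangleInCopy bip i≡j (trans (sym i≡j) (sameCopy ux (inj₁ a≢r))) eq)
    where
    i≡j : i ≡ j
    i≡j = sameCopy uv (inj₁ a≢r)
  ... | uv , vx , ux | yes _ | no b≢r | _ =
    ⊥-elim (noTriangleInCopy bip (sameCopy uv (inj₂ b≢r)) (sameCopy vx (inj₁ b≢r)) eq)
  ... | uv , vx , ux | yes _ | yes _ | no d≢r =
    ⊥-elim (noTriangleInCopy bip (trans (sameCopy ux (inj₂ d≢r)) (sym j≡k)) j≡k eq)
    where
    j≡k : j ≡ k
    j≡k = sameCopy vx (inj₂ d≢r)

  rootTriangle : (∀ i → σ i i ≡ nothing) → (π r r ≡ nothing)
    → ∀ i j k → triangleSign ρ (i , r) (j , r) (k , r) ≡ triangleSign σ i j k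
  rootTriangle σ-loopless π-loopless i j k =
    cong₂ _·_ (layer i j) (cong₂ _·_ (layer j k) (layer i k))
    where
    layer : ∀ i j → ρ (i , r) (j , r) ≡ σ i j
    layer = rootLayer σ-loopless π-loopless

  productTriangle : IsBipartite π → (∀ i → σ i i ≡ nothing) → (π r r ≡ nothing)
    → ∀ u v x {s} → triangleSign ρ u v x ≡ just s
    → triangleSign σ (proj₁ u) (proj₁ v) (proj₁ x) ≡ just s
  productTriangle bip σ-loopless π-loopless (i , a) (j , b) (k , d) eq
    with triangleAtRoots bip i j k a b d eq
  ... | refl , refl , refl = trans (sym (rootTriangle σ-loopless π-loopless i j k)) eq

  rootReversal : IsBipartite π → (∀ i → σ i i ≡ nothing) → (π r r ≡ nothing)
    → ∀ f → ReversesTriangles ρ ρ f → ReversesTriangles σ σ (λ i → proj₁ (f (i , r)))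
  rootReversal bip σ-loopless π-loopless f reverses i j k s eq =
    productTriangle bip σ-loopless π-loopless (f (i , r)) (f (j , r)) (f (k , r))
      (reverses (i , r) (j , r) (k , r) s (trans (rootTriangle σ-loopless π-loopless i j k) eq))

-- Soundness: a satisfying map with values among the candidates
-- is never pruned, so if the search fails no satisfying map exists.
module Backtracking {A B : Set} (candidates : List B) (ok : A → A → A → B → B → B → Bool) where

  Satisfies : (A → B) → Set
  Satisfies f = ∀ j k l → T (ok j k l (f j) (f k) (f l))

  Assignment : Set
  Assignment = List (A × B)

  compatible : A → B → Assignment → Bool
  compatible v y []             = true
  compatible v y ((a , x) ∷ α) =
    all (λ bz → ok v a (proj₁ bz) y x (proj₂ bz)) α ∧ compatible v y α

  extendable : List A → Assignment → Bool
  extendable []       α = true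
  extendable (v ∷ vs) α = any (λ y → compatible v y α ∧ extendable vs ((v , y) ∷ α)) candidates

  Agrees : (A → B) → Assignment → Set
  Agrees f = All (λ ax → f (proj₁ ax) ≡ proj₂ ax)

  compatible-sound : ∀ {f} → Satisfies f → ∀ v α → Agrees f α → T (compatible v (f v) α)
  compatible-sound sat v []             []           = tt
  compatible-sound sat v ((a , _) ∷ α) (refl ∷ agr) =
    Equivalence.from T-∧ (all⁻ _ (All.map pairOk agr) , compatible-sound sat v α agr)
    where
    pairOk : ∀ {bz} → _ ≡ proj₂ bz → T (ok v a (proj₁ bz) _ _ (proj₂ bz))
    pairOk {b , _} refl = sat v a b

  extendable-sound : ∀ {f} → Satisfies f → (∀ v → f v ∈ candidates)
    → ∀ vs α → Agrees f α → T (extendable vs α)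
  extendable-sound sat cand []       α agr = tt
  extendable-sound {f} sat cand (v ∷ vs) α agr = any⁺ _ (Any.map extend (cand v))
    where
    extend : ∀ {y} → f v ≡ y → T (compatible v y α ∧ extendable vs ((v , y) ∷ α))
    extend refl = Equivalence.from T-∧
      (compatible-sound sat v α agr , extendable-sound sat cand vs ((v , f v) ∷ α) (refl ∷ agr))

isReversal : Maybe Sign → Maybe Sign → Bool
isReversal (just pos) (just neg) = true
isReversal (just neg) (just pos) = true
isReversal (just _)   _          = false
isReversal nothing    _          = true

isReversal-opposite : ∀ s → T (isReversal (just s) (just (opposite s)))
isReversal-opposite pos = tt
isReversal-opposite neg = tt

reversalConstraint : (j k l x y z : Fin 8) → Bool
reversalConstraint j k l x y z = isReversal (triangleSign SK8 j k l) (triangleSign SK8 x y z)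

open Backtracking (allFin 8) reversalConstraint using (Satisfies; extendable; extendable-sound)

reversal⇒satisfies : ∀ f → ReversesTriangles SK8 SK8 f → Satisfies f
reversal⇒satisfies f reverses j k l with triangleSign SK8 j k l in jkl
... | nothing = tt
... | just s  = subst (λ t → T (isReversal (just s) t))
                      (sym (reverses j k l s jkl)) (isReversal-opposite s)

-- The search fails: T (extendable searchOrder []) normalises to ⊥.  Any order
-- of the vertices would do; this one keeps the search tree small.
SK8-noReversal : ∀ f → ReversesTriangles SK8 SK8 f → ⊥
SK8-noReversal f reverses =
  extendable-sound (reversal⇒satisfies f reverses) (λ v → ∈-allFin (f v)) searchOrder [] []
  where
  searchOrder : List (Fin 8)
  searchOrder = # 2 ∷ # 0 ∷ # 1 ∷ # 7 ∷ # 5 ∷ # 4 ∷ # 3 ∷ # 6 ∷ []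

SK8-loopless : ∀ i → SK8 i i ≡ nothing
SK8-loopless i with i ≟ᶠ i
... | yes _  = refl
... | no i≢i = ⊥-elim (i≢i refl)

mainTheorem3 : (m : ℕ) (π : SignFn (Fin m)) (r : Fin m)
    → IsSignedGraph π → IsBipartite π
    → ¬ SignSymmetric decProd (rootedProduct SK8 π r)
mainTheorem3 m π r graph bipartite symmetric
  with signSymmetric⇒reversal decProd (rootedProduct SK8 π r) symmetric
... | f , reverses =
  SK8-noReversal _ (rootReversal bipartite SK8-loopless (IsSignedGraph.loopless graph r) f reverses)
  where open RootedProduct SK8 π r using (rootReversal)
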